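{- For every $n\in\mathbb{N}$, the following polynomial identity in $x$ holds: $$-\sum_{k=0}^{n}\binom{n}{k}x^k\sum_{m=1}^{n-k}\frac{(-x)^m}{m}=\sum_{k=1}^{n}\binom{n}{k}x^k\sum_{m=1}^{k}\frac{1}{m+n-k}.$$
   Context: Sums whose upper limit is smaller than the lower limit are empty (equal to $0$). -}

module Defs where

open import Data.Nat using (ℕ; zero; suc; _∸_)
import Data.Nat as ℕ
open import Data.Nat.Combinatorics using (_C_)
open import Data.Integer using (+_)
open import Data.Rational using (ℚ; 0ℚ; 1ℚ; _+_; _*_; _/_)

toℚ : ℕ → ℚ
toℚ k = (+ k) / 1

_^_ : ℚ → ℕ → ℚ
x ^ zero = 1ℚ
x ^ suc k = x * (x ^ k)

-- 1/m for a natural m; only ever used with m ≥ 1 (value at 0 is irrelevant, set to 0)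
recip : ℕ → ℚ
recip zero = 0ℚ
recip (suc k) = (+ 1) / suc k

binomℚ : ℕ → ℕ → ℚ
binomℚ n k = toℚ (n C k)

sumFrom : ℕ → ℕ → (ℕ → ℚ) → ℚ
sumFrom a zero f = 0ℚ
sumFrom a (suc c) f = f a + sumFrom (suc a) c f

-- Σ_{m=a}^{b} f m ; empty (= 0) when b < a
Σ[_⋯_] : ℕ → ℕ → (ℕ → ℚ) → ℚ
Σ[ a ⋯ b ] f = sumFrom a (suc b ∸ a) f

{-# OPTIONS --safe #-}
-- Write L(n) and R(n) for the binomial transforms Σₖ C(n,k) xᵏ gₙ(k) of the two
-- sides. Pascal's rule C(n+1,k+1) = C(n,k) + C(n,k+1) and the absorption
-- C(n,k)/(n+1-k) = C(n+1,k)/(n+1) turn both -L and R into solutions of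
-- f(n+1) = (1+x) f(n) + xⁿ⁺¹/(n+1) with f(0) = 0, so they coincide.
-- The inhomogeneous term comes from the integrated binomial theorem
-- Σₖ C(n,k) xᵏ yⁿ⁺¹⁻ᵏ/(n+1-k) = ((x+y)ⁿ⁺¹ - xⁿ⁺¹)/(n+1), used at y = -x and y = 1.
module Submission where

open import Defs
open import Data.Nat using (ℕ; zero; suc; _∸_; _≤_; _<_; z≤n; s≤s)
import Data.Nat as ℕ
import Data.Nat.Properties as ℕ
open import Data.Nat.Combinatorics
  using (_C_; nC1≡n; nCn≡1; nCk≡nC[n∸k]; nCk+nC[k+1]≡[n+1]C[k+1]; k>n⇒nCk≡0)
open import Function using (_∘_)
open import Relation.Binary.PropositionalEquality

module NatBinomial where

  open import Data.Nat using (_+_; _*_)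
  open import Data.Nat.Tactic.RingSolver using (solve-∀)
  open ≡-Reasoning

  [k+1]*[n+1]C[k+1]≡[n+1]*nCk : ∀ n k → suc k * (suc n C suc k) ≡ suc n * (n C k)
  [k+1]*[n+1]C[k+1]≡[n+1]*nCk n zero =
    trans (ℕ.*-identityˡ _) (trans (nC1≡n (suc n)) (sym (ℕ.*-identityʳ (suc n))))
  [k+1]*[n+1]C[k+1]≡[n+1]*nCk zero (suc k) = begin
    suc (suc k) * (1 C suc (suc k))  ≡⟨ cong (suc (suc k) *_) (k>n⇒nCk≡0 {1} {suc (suc k)} (s≤s (s≤s z≤n))) ⟩
    suc (suc k) * 0                  ≡⟨ ℕ.*-zeroʳ (suc (suc k)) ⟩
    0                                ≡⟨ cong (1 *_) (k>n⇒nCk≡0 {0} {suc k} (s≤s z≤n)) ⟨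
    1 * (0 C suc k)                  ∎
  [k+1]*[n+1]C[k+1]≡[n+1]*nCk (suc n) (suc k) = begin
    suc (suc k) * (suc (suc n) C suc (suc k))
      ≡⟨ cong (suc (suc k) *_) (nCk+nC[k+1]≡[n+1]C[k+1] (suc n) (suc k)) ⟨
    suc (suc k) * (a + b)
      ≡⟨ expand (suc k) a b ⟩
    a + (suc k * a + suc (suc k) * b)
      ≡⟨ cong₂ (λ u v → a + (u + v)) ([k+1]*[n+1]C[k+1]≡[n+1]*nCk n k)
                                     ([k+1]*[n+1]C[k+1]≡[n+1]*nCk n (suc k)) ⟩
    a + (suc n * (n C k) + suc n * (n C suc k))
      ≡⟨ cong (a +_) (ℕ.*-distribˡ-+ (suc n) (n C k) (n C suc k)) ⟨
    a + suc n * (n C k + n C suc k)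
      ≡⟨ cong (λ c → a + suc n * c) (nCk+nC[k+1]≡[n+1]C[k+1] n k) ⟩
    a + suc n * a
      ∎
    where
    a = suc n C suc k
    b = suc n C suc (suc k)
    expand : ∀ j a b → suc j * (a + b) ≡ a + (j * a + suc j * b)
    expand = solve-∀

  [n+1-k]*[n+1]Ck≡[n+1]*nCk : ∀ {n k} → k ≤ n → suc (n ∸ k) * (suc n C k) ≡ suc n * (n C k)
  [n+1-k]*[n+1]Ck≡[n+1]*nCk {n} {k} k≤n = begin
    suc (n ∸ k) * (suc n C k)            ≡⟨ cong (suc (n ∸ k) *_) (nCk≡nC[n∸k] (ℕ.m≤n⇒m≤1+n k≤n)) ⟩
    suc (n ∸ k) * (suc n C (suc n ∸ k))  ≡⟨ cong (λ j → suc (n ∸ k) * (suc n C j)) (ℕ.+-∸-assoc 1 k≤n) ⟩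
    suc (n ∸ k) * (suc n C suc (n ∸ k))  ≡⟨ [k+1]*[n+1]C[k+1]≡[n+1]*nCk n (n ∸ k) ⟩
    suc n * (n C (n ∸ k))                ≡⟨ cong (suc n *_) (nCk≡nC[n∸k] k≤n) ⟨
    suc n * (n C k)                      ∎

open NatBinomial using ([n+1-k]*[n+1]Ck≡[n+1]*nCk)

open import Data.Nat.Coprimality using (1-coprimeTo)
import Data.Nat.Coprimality as Coprime
import Data.Integer as ℤ
import Data.Integer.Properties as ℤ
open import Data.Rational using (ℚ; mkℚ; 0ℚ; 1ℚ; _+_; _*_; -_; _-_; toℚᵘ; fromℚᵘ)
open import Data.Rational.Properties
open import Data.Rational.Unnormalised as ℚᵘ using (mkℚᵘ; *≡*)
import Data.Rational.Unnormalised.Properties as ℚᵘ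
open import Level using (0ℓ)
open import Relation.Nullary.Decidable using (dec⇒maybe)
open import Tactic.RingSolver using (solve-∀)
open import Tactic.RingSolver.Core.AlmostCommutativeRing
  using (AlmostCommutativeRing; fromCommutativeRing)

ℚ-ring : AlmostCommutativeRing 0ℓ 0ℓ
ℚ-ring = fromCommutativeRing +-*-commutativeRing (λ q → dec⇒maybe (0ℚ ≟ q))

fromℚᵘ-homo-+ : ∀ p q → fromℚᵘ (p ℚᵘ.+ q) ≡ fromℚᵘ p + fromℚᵘ q
fromℚᵘ-homo-+ p q = toℚᵘ-injective (begin
  toℚᵘ (fromℚᵘ (p ℚᵘ.+ q))              ≈⟨ toℚᵘ-fromℚᵘ (p ℚᵘ.+ q) ⟩
  p ℚᵘ.+ q                              ≈⟨ ℚᵘ.+-cong (toℚᵘ-fromℚᵘ p) (toℚᵘ-fromℚᵘ q) ⟨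
  toℚᵘ (fromℚᵘ p) ℚᵘ.+ toℚᵘ (fromℚᵘ q)  ≈⟨ toℚᵘ-homo-+ (fromℚᵘ p) (fromℚᵘ q) ⟨
  toℚᵘ (fromℚᵘ p + fromℚᵘ q)            ∎)
  where open ℚᵘ.≃-Reasoning

fromℚᵘ-homo-* : ∀ p q → fromℚᵘ (p ℚᵘ.* q) ≡ fromℚᵘ p * fromℚᵘ q
fromℚᵘ-homo-* p q = toℚᵘ-injective (begin
  toℚᵘ (fromℚᵘ (p ℚᵘ.* q))              ≈⟨ toℚᵘ-fromℚᵘ (p ℚᵘ.* q) ⟩
  p ℚᵘ.* q                              ≈⟨ ℚᵘ.*-cong (toℚᵘ-fromℚᵘ p) (toℚᵘ-fromℚᵘ q) ⟨
  toℚᵘ (fromℚᵘ p) ℚᵘ.* toℚᵘ (fromℚᵘ q)  ≈⟨ toℚᵘ-homo-* (fromℚᵘ p) (fromℚᵘ q) ⟨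
  toℚᵘ (fromℚᵘ p * fromℚᵘ q)            ∎)
  where open ℚᵘ.≃-Reasoning

-- toℚ k is fromℚᵘ (mkℚᵘ (+ k) 0) by definition.
toℚ-+ : ∀ a b → toℚ (a ℕ.+ b) ≡ toℚ a + toℚ b
toℚ-+ a b =
  trans (fromℚᵘ-cong {mkℚᵘ (ℤ.+ (a ℕ.+ b)) 0} {a′ ℚᵘ.+ b′} (*≡* numerators)) (fromℚᵘ-homo-+ a′ b′)
  where
  a′ = mkℚᵘ (ℤ.+ a) 0
  b′ = mkℚᵘ (ℤ.+ b) 0
  numerators : ℤ.+ (a ℕ.+ b) ℤ.* ℤ.+ 1 ≡ (ℤ.+ a ℤ.* ℤ.+ 1 ℤ.+ ℤ.+ b ℤ.* ℤ.+ 1) ℤ.* ℤ.+ 1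
  numerators = cong (ℤ._* ℤ.+ 1)
    (trans (ℤ.pos-+ a b) (sym (cong₂ ℤ._+_ (ℤ.*-identityʳ (ℤ.+ a)) (ℤ.*-identityʳ (ℤ.+ b)))))

toℚ-* : ∀ a b → toℚ (a ℕ.* b) ≡ toℚ a * toℚ b
toℚ-* a b = trans (cong (λ z → fromℚᵘ (mkℚᵘ z 0)) (ℤ.pos-* a b))
                  (fromℚᵘ-homo-* (mkℚᵘ (ℤ.+ a) 0) (mkℚᵘ (ℤ.+ b) 0))

recip-inverseˡ : ∀ k → recip (suc k) * toℚ (suc k) ≡ 1ℚ
recip-inverseˡ k = trans (cong₂ _*_ (normalize-coprime (1-coprimeTo (suc k))) (normalize-coprime c))
                         (*-inverseˡ (mkℚ (ℤ.+ suc k) 0 c))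
  where c = Coprime.sym (1-coprimeTo (suc k))

recip-cancelˡ : ∀ k q → recip (suc k) * (toℚ (suc k) * q) ≡ q
recip-cancelˡ k q = begin
  recip (suc k) * (toℚ (suc k) * q)  ≡⟨ *-assoc (recip (suc k)) (toℚ (suc k)) q ⟨
  recip (suc k) * toℚ (suc k) * q    ≡⟨ cong (_* q) (recip-inverseˡ k) ⟩
  1ℚ * q                             ≡⟨ *-identityˡ q ⟩
  q                                  ∎
  where open ≡-Reasoning

recip-swap : ∀ {a b u v} → suc a ℕ.* u ≡ suc b ℕ.* v → toℚ v * recip (suc a) ≡ recip (suc b) * toℚ u
recip-swap {a} {b} {u} {v} eq = begin
  toℚ v * ra                         ≡⟨ cong (_* ra) (recip-cancelˡ b (toℚ v)) ⟨
  rb * (toℚ (suc b) * toℚ v) * ra    ≡⟨ cong (λ z → rb * z * ra) cross ⟩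
  rb * (toℚ (suc a) * toℚ u) * ra    ≡⟨ *-assoc rb _ ra ⟩
  rb * (toℚ (suc a) * toℚ u * ra)    ≡⟨ cong (rb *_) (*-comm _ ra) ⟩
  rb * (ra * (toℚ (suc a) * toℚ u))  ≡⟨ cong (rb *_) (recip-cancelˡ a (toℚ u)) ⟩
  rb * toℚ u                         ∎
  where
  open ≡-Reasoning
  ra = recip (suc a)
  rb = recip (suc b)
  cross : toℚ (suc b) * toℚ v ≡ toℚ (suc a) * toℚ u
  cross = trans (sym (toℚ-* (suc b) v)) (trans (cong toℚ (sym eq)) (toℚ-* (suc a) u))

binomℚ-pascal : ∀ n k → binomℚ (suc n) (suc k) ≡ binomℚ n k + binomℚ n (suc k)
binomℚ-pascal n k = trans (cong toℚ (sym (nCk+nC[k+1]≡[n+1]C[k+1] n k))) (toℚ-+ (n C k) (n C suc k))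

binomℚ-absorb : ∀ {n k} → k ≤ n → binomℚ n k * recip (suc n ∸ k) ≡ recip (suc n) * binomℚ (suc n) k
binomℚ-absorb {n} {k} k≤n =
  trans (cong (λ j → binomℚ n k * recip j) (ℕ.+-∸-assoc 1 k≤n))
        (recip-swap {n ∸ k} {n} {suc n C k} {n C k} ([n+1-k]*[n+1]Ck≡[n+1]*nCk k≤n))

sumFrom-suc : ∀ a c (f : ℕ → ℚ) → sumFrom (suc a) c f ≡ sumFrom a c (f ∘ suc)
sumFrom-suc a zero    f = refl
sumFrom-suc a (suc c) f = cong (f (suc a) +_) (sumFrom-suc (suc a) c f)

sumFrom-snoc : ∀ a c (f : ℕ → ℚ) → sumFrom a (suc c) f ≡ sumFrom a c f + f (a ℕ.+ c)
sumFrom-snoc a zero    f = trans (+-comm (f a) 0ℚ) (cong (λ i → 0ℚ + f i) (sym (ℕ.+-identityʳ a)))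
sumFrom-snoc a (suc c) f = begin
  f a + sumFrom (suc a) (suc c) f                ≡⟨ cong (f a +_) (sumFrom-snoc (suc a) c f) ⟩
  f a + (sumFrom (suc a) c f + f (suc a ℕ.+ c))  ≡⟨ +-assoc (f a) _ _ ⟨
  sumFrom a (suc c) f + f (suc (a ℕ.+ c))        ≡⟨ cong (λ i → sumFrom a (suc c) f + f i) (ℕ.+-suc a c) ⟨
  sumFrom a (suc c) f + f (a ℕ.+ suc c)          ∎
  where open ≡-Reasoning

sumFrom-cong : ∀ a c {f g : ℕ → ℚ} → (∀ i → i < a ℕ.+ c → f i ≡ g i) → sumFrom a c f ≡ sumFrom a c g
sumFrom-cong a zero    f≗g = refl
sumFrom-cong a (suc c) f≗g = cong₂ _+_ (f≗g a (ℕ.m<m+n a (s≤s z≤n)))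
  (sumFrom-cong (suc a) c (λ i i<1+a+c → f≗g i (subst (i <_) (sym (ℕ.+-suc a c)) i<1+a+c)))

sumFrom-+ : ∀ a c (f g : ℕ → ℚ) → sumFrom a c (λ i → f i + g i) ≡ sumFrom a c f + sumFrom a c g
sumFrom-+ a zero    f g = refl
sumFrom-+ a (suc c) f g =
  trans (cong (f a + g a +_) (sumFrom-+ (suc a) c f g)) (interchange (f a) (g a) _ _)
  where
  interchange : ∀ p q r s → p + q + (r + s) ≡ p + r + (q + s)
  interchange = solve-∀ ℚ-ring

sumFrom-*ˡ : ∀ a c r (f : ℕ → ℚ) → sumFrom a c (λ i → r * f i) ≡ r * sumFrom a c f
sumFrom-*ˡ a zero    r f = sym (*-zeroʳ r)
sumFrom-*ˡ a (suc c) r f =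
  trans (cong (r * f a +_) (sumFrom-*ˡ (suc a) c r f)) (sym (*-distribˡ-+ r (f a) _))

sumFrom-neg : ∀ a c (f : ℕ → ℚ) → sumFrom a c (λ i → - f i) ≡ - sumFrom a c f
sumFrom-neg a zero    f = refl
sumFrom-neg a (suc c) f =
  trans (cong (- f a +_) (sumFrom-neg (suc a) c f)) (sym (neg-distrib-+ (f a) _))

1^n≡1 : ∀ n → 1ℚ ^ n ≡ 1ℚ
1^n≡1 zero    = refl
1^n≡1 (suc n) = trans (*-identityˡ (1ℚ ^ n)) (1^n≡1 n)

module BinomialSum (x : ℚ) where

  binomialTerm : ℕ → (ℕ → ℚ) → ℕ → ℚ
  binomialTerm n g k = binomℚ n k * (x ^ k) * g k

  binomialSum : ℕ → (ℕ → ℚ) → ℚ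
  binomialSum n g = sumFrom 0 (suc n) (binomialTerm n g)

  binomialSum-cong : ∀ n {f g : ℕ → ℚ} → (∀ k → k ≤ n → f k ≡ g k) → binomialSum n f ≡ binomialSum n g
  binomialSum-cong n f≗g =
    sumFrom-cong 0 (suc n) (λ k k<1+n → cong (binomℚ n k * (x ^ k) *_) (f≗g k (ℕ.≤-pred k<1+n)))

  binomialSum-+ : ∀ n (f g : ℕ → ℚ) → binomialSum n (λ k → f k + g k) ≡ binomialSum n f + binomialSum n g
  binomialSum-+ n f g =
    trans (sumFrom-cong 0 (suc n) (λ k _ → *-distribˡ-+ (binomℚ n k * (x ^ k)) (f k) (g k)))
          (sumFrom-+ 0 (suc n) (binomialTerm n f) (binomialTerm n g))

  binomialSum-*ˡ : ∀ n r (f : ℕ → ℚ) → binomialSum n (λ k → r * f k) ≡ r * binomialSum n f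
  binomialSum-*ˡ n r f =
    trans (sumFrom-cong 0 (suc n) (λ k _ → pull (binomℚ n k * (x ^ k)) r (f k)))
          (sumFrom-*ˡ 0 (suc n) r (binomialTerm n f))
    where
    pull : ∀ b r y → b * (r * y) ≡ r * (b * y)
    pull = solve-∀ ℚ-ring

  binomialSum-neg : ∀ n (f : ℕ → ℚ) → binomialSum n (λ k → - f k) ≡ - binomialSum n f
  binomialSum-neg n f =
    trans (sumFrom-cong 0 (suc n) (λ k _ → sym (neg-distribʳ-* (binomℚ n k * (x ^ k)) (f k))))
          (sumFrom-neg 0 (suc n) (binomialTerm n f))

  -- The extra summand vanishes because C(n, n+1) = 0.
  binomialSum-extend : ∀ n g → sumFrom 0 (suc (suc n)) (binomialTerm n g) ≡ binomialSum n g
  binomialSum-extend n g = begin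
    sumFrom 0 (suc (suc n)) (binomialTerm n g)  ≡⟨ sumFrom-snoc 0 (suc n) (binomialTerm n g) ⟩
    binomialSum n g + binomialTerm n g (suc n)  ≡⟨ cong (binomialSum n g +_) top≡0 ⟩
    binomialSum n g + 0ℚ                        ≡⟨ +-identityʳ _ ⟩
    binomialSum n g                             ∎
    where
    open ≡-Reasoning
    top≡0 : binomialTerm n g (suc n) ≡ 0ℚ
    top≡0 = begin
      binomialTerm n g (suc n)
        ≡⟨ cong (λ c → toℚ c * (x ^ suc n) * g (suc n)) (k>n⇒nCk≡0 (ℕ.n<1+n n)) ⟩
      0ℚ * (x ^ suc n) * g (suc n)
        ≡⟨ cong (_* g (suc n)) (*-zeroˡ (x ^ suc n)) ⟩
      0ℚ * g (suc n)
        ≡⟨ *-zeroˡ (g (suc n)) ⟩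
      0ℚ
        ∎

  binomialSum-pascal : ∀ n g → binomialSum (suc n) g ≡ binomialSum n g + x * binomialSum n (g ∘ suc)
  binomialSum-pascal n g = begin
    binomialSum (suc n) g
      ≡⟨ cong (T 0 +_) (sumFrom-suc 0 (suc n) (binomialTerm (suc n) g)) ⟩
    T 0 + sumFrom 0 (suc n) (binomialTerm (suc n) g ∘ suc)
      ≡⟨ cong (T 0 +_) (sumFrom-cong 0 (suc n) (λ k _ → pascal-term k)) ⟩
    T 0 + sumFrom 0 (suc n) (λ k → x * T′ k + T (suc k))
      ≡⟨ cong (T 0 +_) (sumFrom-+ 0 (suc n) (λ k → x * T′ k) (T ∘ suc)) ⟩
    T 0 + (sumFrom 0 (suc n) (λ k → x * T′ k) + sumFrom 0 (suc n) (T ∘ suc))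
      ≡⟨ cong₂ (λ u v → T 0 + (u + v)) (sumFrom-*ˡ 0 (suc n) x T′) (sym (sumFrom-suc 0 (suc n) T)) ⟩
    T 0 + (x * binomialSum n (g ∘ suc) + sumFrom 1 (suc n) T)
      ≡⟨ swap (T 0) _ _ ⟩
    sumFrom 0 (suc (suc n)) T + x * binomialSum n (g ∘ suc)
      ≡⟨ cong (_+ x * binomialSum n (g ∘ suc)) (binomialSum-extend n g) ⟩
    binomialSum n g + x * binomialSum n (g ∘ suc)
      ∎
    where
    open ≡-Reasoning
    T T′ : ℕ → ℚ
    T  = binomialTerm n g
    T′ = binomialTerm n (g ∘ suc)
    split : ∀ x b b′ y z → (b + b′) * (x * y) * z ≡ x * (b * y * z) + b′ * (x * y) * z
    split = solve-∀ ℚ-ring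
    pascal-term : ∀ k → binomialTerm (suc n) g (suc k) ≡ x * T′ k + T (suc k)
    pascal-term k = trans (cong (λ b → b * (x ^ suc k) * g (suc k)) (binomℚ-pascal n k))
                          (split x (binomℚ n k) (binomℚ n (suc k)) (x ^ k) (g (suc k)))
    swap : ∀ a b c → a + (b + c) ≡ a + c + b
    swap = solve-∀ ℚ-ring

  binomial-theorem : ∀ n y → binomialSum n (λ k → y ^ (n ∸ k)) ≡ (x + y) ^ n
  binomial-theorem zero    y = refl
  binomial-theorem (suc n) y = begin
    binomialSum (suc n) (λ k → y ^ (suc n ∸ k))
      ≡⟨ binomialSum-pascal n (λ k → y ^ (suc n ∸ k)) ⟩
    binomialSum n (λ k → y ^ (suc n ∸ k)) + x * S
      ≡⟨ cong (_+ x * S) (binomialSum-cong n (λ k k≤n → cong (y ^_) (ℕ.+-∸-assoc 1 k≤n))) ⟩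
    binomialSum n (λ k → y * y ^ (n ∸ k)) + x * S
      ≡⟨ cong (_+ x * S) (binomialSum-*ˡ n y _) ⟩
    y * S + x * S
      ≡⟨ cong (λ s → y * s + x * s) (binomial-theorem n y) ⟩
    y * (x + y) ^ n + x * (x + y) ^ n
      ≡⟨ collect x y ((x + y) ^ n) ⟩
    (x + y) ^ suc n
      ∎
    where
    open ≡-Reasoning
    S = binomialSum n (λ k → y ^ (n ∸ k))
    collect : ∀ x y p → y * p + x * p ≡ (x + y) * p
    collect = solve-∀ ℚ-ring

  binomialSum-const : ∀ n r → binomialSum n (λ _ → r) ≡ r * (x + 1ℚ) ^ n
  binomialSum-const n r = begin
    binomialSum n (λ _ → r)                 ≡⟨ binomialSum-cong n (λ k _ → pad (n ∸ k)) ⟩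
    binomialSum n (λ k → r * 1ℚ ^ (n ∸ k))  ≡⟨ binomialSum-*ˡ n r _ ⟩
    r * binomialSum n (λ k → 1ℚ ^ (n ∸ k))  ≡⟨ cong (r *_) (binomial-theorem n 1ℚ) ⟩
    r * (x + 1ℚ) ^ n                        ∎
    where
    open ≡-Reasoning
    pad : ∀ j → r ≡ r * 1ℚ ^ j
    pad j = sym (trans (cong (r *_) (1^n≡1 j)) (*-identityʳ r))

  binomial-theorem-without-top : ∀ n y →
    sumFrom 0 (suc n) (binomialTerm (suc n) (λ k → y ^ (suc n ∸ k))) ≡ (x + y) ^ suc n - x ^ suc n
  binomial-theorem-without-top n y = begin
    S                                                        ≡⟨ cancel S (x ^ suc n) ⟩
    S + x ^ suc n - x ^ suc n                                ≡⟨ cong (λ t → S + t - x ^ suc n) top ⟨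
    S + T (suc n) - x ^ suc n                                ≡⟨ cong (_- x ^ suc n) (sumFrom-snoc 0 (suc n) T) ⟨
    binomialSum (suc n) (λ k → y ^ (suc n ∸ k)) - x ^ suc n  ≡⟨ cong (_- x ^ suc n) (binomial-theorem (suc n) y) ⟩
    (x + y) ^ suc n - x ^ suc n                              ∎
    where
    open ≡-Reasoning
    T = binomialTerm (suc n) (λ k → y ^ (suc n ∸ k))
    S = sumFrom 0 (suc n) T
    cancel : ∀ s t → s ≡ s + t - t
    cancel = solve-∀ ℚ-ring
    top : T (suc n) ≡ x ^ suc n
    top = begin
      binomℚ (suc n) (suc n) * (x ^ suc n) * y ^ (suc n ∸ suc n)
        ≡⟨ cong₂ (λ c j → toℚ c * (x ^ suc n) * y ^ j) (nCn≡1 (suc n)) (ℕ.n∸n≡0 n) ⟩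
      1ℚ * (x ^ suc n) * 1ℚ
        ≡⟨ *-identityʳ _ ⟩
      1ℚ * (x ^ suc n)
        ≡⟨ *-identityˡ _ ⟩
      x ^ suc n
        ∎

  binomial-theorem-integrated : ∀ n y →
    binomialSum n (λ k → y ^ (suc n ∸ k) * recip (suc n ∸ k)) ≡ recip (suc n) * ((x + y) ^ suc n - x ^ suc n)
  binomial-theorem-integrated n y = begin
    binomialSum n (λ k → y ^ (suc n ∸ k) * recip (suc n ∸ k))
      ≡⟨ sumFrom-cong 0 (suc n) (λ k k<1+n → absorb k (ℕ.≤-pred k<1+n)) ⟩
    sumFrom 0 (suc n) (λ k → recip (suc n) * T k)
      ≡⟨ sumFrom-*ˡ 0 (suc n) (recip (suc n)) T ⟩
    recip (suc n) * sumFrom 0 (suc n) T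
      ≡⟨ cong (recip (suc n) *_) (binomial-theorem-without-top n y) ⟩
    recip (suc n) * ((x + y) ^ suc n - x ^ suc n)
      ∎
    where
    open ≡-Reasoning
    T = binomialTerm (suc n) (λ k → y ^ (suc n ∸ k))
    regroup₁ : ∀ b p q r → b * p * (q * r) ≡ b * r * (p * q)
    regroup₁ = solve-∀ ℚ-ring
    regroup₂ : ∀ r b p q → r * b * (p * q) ≡ r * (b * p * q)
    regroup₂ = solve-∀ ℚ-ring
    absorb : ∀ k → k ≤ n → binomialTerm n (λ k → y ^ (suc n ∸ k) * recip (suc n ∸ k)) k ≡ recip (suc n) * T k
    absorb k k≤n = begin
      binomℚ n k * (x ^ k) * (y ^ (suc n ∸ k) * recip (suc n ∸ k))
        ≡⟨ regroup₁ (binomℚ n k) (x ^ k) _ _ ⟩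
      binomℚ n k * recip (suc n ∸ k) * ((x ^ k) * y ^ (suc n ∸ k))
        ≡⟨ cong (_* ((x ^ k) * y ^ (suc n ∸ k))) (binomℚ-absorb k≤n) ⟩
      recip (suc n) * binomℚ (suc n) k * ((x ^ k) * y ^ (suc n ∸ k))
        ≡⟨ regroup₂ (recip (suc n)) (binomℚ (suc n) k) _ _ ⟩
      recip (suc n) * T k
        ∎

module Transforms (x : ℚ) where

  open BinomialSum x

  logSeries : ℕ → ℚ
  logSeries N = sumFrom 1 N (λ m → (- x) ^ m * recip m)

  logTransform : ℕ → ℚ
  logTransform n = binomialSum n (λ k → logSeries (n ∸ k))

  logTransform-suc : ∀ n → logTransform (suc n) ≡ (1ℚ + x) * logTransform n - recip (suc n) * x ^ suc n
  logTransform-suc n = begin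
    logTransform (suc n)
      ≡⟨ binomialSum-pascal n (λ k → logSeries (suc n ∸ k)) ⟩
    binomialSum n (λ k → logSeries (suc n ∸ k)) + x * L
      ≡⟨ cong (_+ x * L) (binomialSum-cong n logSeries-step) ⟩
    binomialSum n (λ k → logSeries (n ∸ k) + E k) + x * L
      ≡⟨ cong (_+ x * L) (binomialSum-+ n (λ k → logSeries (n ∸ k)) E) ⟩
    L + binomialSum n E + x * L
      ≡⟨ cong (λ s → L + s + x * L) (binomial-theorem-integrated n (- x)) ⟩
    L + recip (suc n) * ((x + - x) ^ suc n - x ^ suc n) + x * L
      ≡⟨ cong (λ z → L + recip (suc n) * (z - x ^ suc n) + x * L) vanish ⟩
    L + recip (suc n) * (0ℚ - x ^ suc n) + x * L
      ≡⟨ collect x L (recip (suc n)) (x ^ suc n) ⟩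
    (1ℚ + x) * L - recip (suc n) * x ^ suc n
      ∎
    where
    open ≡-Reasoning
    L = logTransform n
    E : ℕ → ℚ
    E k = (- x) ^ (suc n ∸ k) * recip (suc n ∸ k)
    logSeries-step : ∀ k → k ≤ n → logSeries (suc n ∸ k) ≡ logSeries (n ∸ k) + E k
    logSeries-step k k≤n rewrite ℕ.+-∸-assoc 1 k≤n = sumFrom-snoc 1 (n ∸ k) _
    vanish : (x + - x) ^ suc n ≡ 0ℚ
    vanish = trans (cong (_* (x + - x) ^ n) (+-inverseʳ x)) (*-zeroˡ ((x + - x) ^ n))
    collect : ∀ x l r p → l + r * (0ℚ - p) + x * l ≡ (1ℚ + x) * l - r * p
    collect = solve-∀ ℚ-ring

  -- For k ≤ n this is the harmonic-number difference H(n) - H(n-k).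
  harmonicGap : ℕ → ℕ → ℚ
  harmonicGap n k = sumFrom 1 k (λ m → recip ((m ℕ.+ n) ∸ k))

  harmonicGap-suc-suc : ∀ n k → harmonicGap (suc n) (suc k) ≡ harmonicGap n k + recip (suc n)
  harmonicGap-suc-suc n k = trans (sumFrom-snoc 1 k _)
    (cong₂ _+_ (sumFrom-cong 1 k (λ m _ → cong (λ j → recip (j ∸ suc k)) (ℕ.+-suc m n)))
               (cong recip (ℕ.m+n∸m≡n k (suc n))))

  harmonicGap-suc : ∀ n k → harmonicGap (suc n) k ≡ harmonicGap n k + recip (suc n) - recip (suc n ∸ k)
  harmonicGap-suc n k = begin
    harmonicGap (suc n) k
      ≡⟨ cancel (harmonicGap (suc n) k) (recip (suc n ∸ k)) ⟩
    recip (suc n ∸ k) + harmonicGap (suc n) k - recip (suc n ∸ k)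
      ≡⟨ cong (λ s → recip (suc n ∸ k) + s - recip (suc n ∸ k)) (sumFrom-suc 1 k _) ⟨
    harmonicGap (suc n) (suc k) - recip (suc n ∸ k)
      ≡⟨ cong (_- recip (suc n ∸ k)) (harmonicGap-suc-suc n k) ⟩
    harmonicGap n k + recip (suc n) - recip (suc n ∸ k)
      ∎
    where
    open ≡-Reasoning
    cancel : ∀ h r → h ≡ r + h - r
    cancel = solve-∀ ℚ-ring

  harmonicTransform : ℕ → ℚ
  harmonicTransform n = binomialSum n (harmonicGap n)

  harmonicTransform-suc : ∀ n →
    harmonicTransform (suc n) ≡ (1ℚ + x) * harmonicTransform n + recip (suc n) * x ^ suc n
  harmonicTransform-suc n = begin
    harmonicTransform (suc n)
      ≡⟨ binomialSum-pascal n (harmonicGap (suc n)) ⟩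
    binomialSum n (harmonicGap (suc n)) + x * binomialSum n (harmonicGap (suc n) ∘ suc)
      ≡⟨ cong₂ (λ u v → u + x * v) (binomialSum-cong n (λ k _ → harmonicGap-suc n k))
                                   (binomialSum-cong n (λ k _ → harmonicGap-suc-suc n k)) ⟩
    binomialSum n (λ k → H′ k - recip (suc n ∸ k)) + x * binomialSum n H′
      ≡⟨ cong (_+ x * binomialSum n H′) (binomialSum-+ n H′ (λ k → - recip (suc n ∸ k))) ⟩
    binomialSum n H′ + binomialSum n (λ k → - recip (suc n ∸ k)) + x * binomialSum n H′
      ≡⟨ cong₂ (λ u v → u + v + x * u) shifted boundary ⟩
    R + r * P + - (r * ((x + 1ℚ) * P - x ^ suc n)) + x * (R + r * P)
      ≡⟨ collect x R r P (x ^ suc n) ⟩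
    (1ℚ + x) * R + r * x ^ suc n
      ∎
    where
    open ≡-Reasoning
    R = harmonicTransform n
    r = recip (suc n)
    P = (x + 1ℚ) ^ n
    H′ : ℕ → ℚ
    H′ k = harmonicGap n k + r
    shifted : binomialSum n H′ ≡ R + r * P
    shifted = trans (binomialSum-+ n (harmonicGap n) (λ _ → r)) (cong (R +_) (binomialSum-const n r))
    one-power : ∀ j → recip j ≡ 1ℚ ^ j * recip j
    one-power j = sym (trans (cong (_* recip j) (1^n≡1 j)) (*-identityˡ (recip j)))
    boundary : binomialSum n (λ k → - recip (suc n ∸ k)) ≡ - (r * ((x + 1ℚ) * P - x ^ suc n))
    boundary = begin
      binomialSum n (λ k → - recip (suc n ∸ k))
        ≡⟨ binomialSum-neg n (λ k → recip (suc n ∸ k)) ⟩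
      - binomialSum n (λ k → recip (suc n ∸ k))
        ≡⟨ cong -_ (binomialSum-cong n (λ k _ → one-power (suc n ∸ k))) ⟩
      - binomialSum n (λ k → 1ℚ ^ (suc n ∸ k) * recip (suc n ∸ k))
        ≡⟨ cong -_ (binomial-theorem-integrated n 1ℚ) ⟩
      - (r * ((x + 1ℚ) * P - x ^ suc n))
        ∎
    collect : ∀ x h r p q → h + r * p + - (r * ((x + 1ℚ) * p - q)) + x * (h + r * p) ≡ (1ℚ + x) * h + r * q
    collect = solve-∀ ℚ-ring

  -logTransform≡harmonicTransform : ∀ n → - logTransform n ≡ harmonicTransform n
  -logTransform≡harmonicTransform zero    = refl
  -logTransform≡harmonicTransform (suc n) = begin
    - logTransform (suc n)                          ≡⟨ cong -_ (logTransform-suc n) ⟩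
    - ((1ℚ + x) * L - r * x ^ suc n)                ≡⟨ negate x L r (x ^ suc n) ⟩
    (1ℚ + x) * - L + r * x ^ suc n                  ≡⟨ cong (λ l → (1ℚ + x) * l + r * x ^ suc n)
                                                            (-logTransform≡harmonicTransform n) ⟩
    (1ℚ + x) * harmonicTransform n + r * x ^ suc n  ≡⟨ harmonicTransform-suc n ⟨
    harmonicTransform (suc n)                       ∎
    where
    open ≡-Reasoning
    L = logTransform n
    r = recip (suc n)
    negate : ∀ x l r p → - ((1ℚ + x) * l - r * p) ≡ (1ℚ + x) * - l + r * p
    negate = solve-∀ ℚ-ring

corollary2p4 : ∀ (n : ℕ) (x : ℚ) →
    - (Σ[ 0 ⋯ n ] λ k → binomℚ n k * (x ^ k) * (Σ[ 1 ⋯ n ∸ k ] λ m → ((- x) ^ m) * recip m))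
      ≡ (Σ[ 1 ⋯ n ] λ k → binomℚ n k * (x ^ k) * (Σ[ 1 ⋯ k ] λ m → recip ((m ℕ.+ n) ∸ k)))
corollary2p4 n x = trans (-logTransform≡harmonicTransform n) (+-identityˡ _)
  -- the k = 0 summand of harmonicTransform n computes to 0ℚ
  where open Transforms x
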